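{- Let $p, q$ be distinct positive integers, and let $m, n$ be positive integers. The grid graph $\square_m$ embeds into the $(p,q)$-leaper graph $\mathcal{L}_n$ if and only if there exist two paths $\alpha$ and $\beta$ in the infinite leaper graph $\mathcal{L}_\mathbb{Z}$, each with $m$ vertices, such that: (i) no vector that is a difference of two distinct vertices of $\alpha$ is also a difference of two distinct vertices of $\beta$; and (ii) if the bounding box of the vertex set of $\alpha$ has size $a_X \times a_Y$ and that of $\beta$ has size $b_X \times b_Y$, then $a_X + b_X \le n + 1$ and $a_Y + b_Y \le n + 1$.
   Context: Let $[n] = \{1, \ldots, n\}$. The grid graph $\square_m$ has vertex set $[m]^2$, with two vertices adjacent iff they are at Euclidean distance $1$. The $(p,q)$-leaper graph $\mathcal{L}_n$ has vertex set $[n]^2$, and $\mathcal{L}_\mathbb{Z}$ has vertex set $\mathbb{Z}^2$; in both, $(x', y')$ and $(x'', y'')$ are adjacent iff $\{|x' - x''|, |y' - y''|\} = \{p, q\}$. A graph $G$ embeds into $H$ if $G$ is isomorphic to a (not necessarily induced) subgraph of $H$. A path is a subgraph isomorphic to a path graph. A box of size $k \times \ell$ is a set $I \times J$ where $I, J$ are sets of consecutive integers of sizes $k$ and $\ell$; the bounding box of a finite set $S \subset \mathbb{Z}^2$ is the smallest box containing $S$. -}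

module Defs where

open import Data.Nat using (ℕ; zero; suc)
open import Data.Integer using (ℤ; +_; _-_; _+_; ∣_∣; _⊔_; _⊓_)
open import Data.Fin using (Fin; toℕ)
open import Data.Product using (_×_; _,_; proj₁; proj₂; Σ)
open import Data.Sum using (_⊎_)
open import Data.List using (List; []; _∷_; map; foldr; allFin)
open import Relation.Binary.PropositionalEquality using (_≡_; _≢_)
open import Function.Definitions using (Injective)

Pt : Set
Pt = ℤ × ℤ

LeapAdj : ℕ → ℕ → Pt → Pt → Set
LeapAdj p q (x₁ , y₁) (x₂ , y₂) =
  (∣ x₁ - x₂ ∣ ≡ p × ∣ y₁ - y₂ ∣ ≡ q) ⊎ (∣ x₁ - x₂ ∣ ≡ q × ∣ y₁ - y₂ ∣ ≡ p)

-- vertices of [n]² represented by Fin n × Fin n (coordinate i+1 ↦ i; a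
-- translation, irrelevant for adjacency)
toPt : {n : ℕ} → Fin n × Fin n → Pt
toPt (i , j) = (+ toℕ i , + toℕ j)

GridAdj : {m : ℕ} → Fin m × Fin m → Fin m × Fin m → Set
GridAdj (a , b) (c , d) =
  (a ≡ c × ∣ + toℕ b - + toℕ d ∣ ≡ 1) ⊎ (b ≡ d × ∣ + toℕ a - + toℕ c ∣ ≡ 1)

LeapAdjₙ : ℕ → ℕ → {n : ℕ} → Fin n × Fin n → Fin n × Fin n → Set
LeapAdjₙ p q u v = LeapAdj p q (toPt u) (toPt v)

GridEmbedsInLeaper : ℕ → ℕ → ℕ → ℕ → Set
GridEmbedsInLeaper p q m n =
  Σ (Fin m × Fin m → Fin n × Fin n) λ f →
    Injective _≡_ _≡_ f × (∀ u v → GridAdj u v → LeapAdjₙ p q (f u) (f v))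

-- a path with m vertices in 𝓛_ℤ: an injective sequence of m points with
-- consecutive points adjacent (a subgraph isomorphic to the path graph P_m)
IsLeaperPath : ℕ → ℕ → (m : ℕ) → (Fin m → Pt) → Set
IsLeaperPath p q m α =
  Injective _≡_ _≡_ α ×
  (∀ (i j : Fin m) → suc (toℕ i) ≡ toℕ j → LeapAdj p q (α i) (α j))

diff : Pt → Pt → Pt
diff (x₁ , y₁) (x₂ , y₂) = (x₁ - x₂ , y₁ - y₂)

DisjointDifferences : {m : ℕ} → (Fin m → Pt) → (Fin m → Pt) → Set
DisjointDifferences {m} α β =
  ∀ (i j k l : Fin m) → α i ≢ α j → β k ≢ β l → diff (α i) (α j) ≢ diff (β k) (β l)

-- max / min of a nonempty list (head as seed; empty list gives 0, unused)
maxL : List ℤ → ℤ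
maxL [] = + 0
maxL (x ∷ xs) = foldr _⊔_ x xs

minL : List ℤ → ℤ
minL [] = + 0
minL (x ∷ xs) = foldr _⊓_ x xs

extent : {m : ℕ} → (Fin m → ℤ) → ℤ
extent {m} f = maxL (map f (allFin m)) - minL (map f (allFin m)) + + 1

widthX : {m : ℕ} → (Fin m → Pt) → ℤ
widthX α = extent (λ i → proj₁ (α i))

widthY : {m : ℕ} → (Fin m → Pt) → ℤ
widthY α = extent (λ i → proj₂ (α i))

-- Write P (i , j) for the image of the grid vertex (i , j). Every unit square of
-- the grid is mapped to a 4-cycle of the leaper graph whose sides all have
-- squared length p² + q², and such a 4-cycle in ℤ² is a parallelogram. Hence
-- P (i , j) = α i + β j with the paths α i = P (i , 0) and β j = P (0 , j) − P (0 , 0).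
-- The map (i , j) ↦ α i + β j is injective exactly when the difference sets of
-- α and β are disjoint, and a translate of it maps into [n]² exactly when the
-- bounding boxes obey the two size bounds; so conversely α and β define an
-- embedding.
module Submission where

open import Defs
open import Data.Nat using (ℕ; suc)
open import Data.Fin using (Fin)
open import Data.Nat using (_<_)
open import Data.Integer using (+_; _+_; _≤_)
open import Data.Product using (_×_; Σ)
open import Function.Bundles using (_⇔_)
open import Relation.Binary.PropositionalEquality using (_≢_)

import Data.Nat as ℕ
import Data.Nat.Properties as ℕP
open import Data.Integer as ℤ using (ℤ; -_; _-_; _*_; ∣_∣; _⊖_; _⊔_; _⊓_)
import Data.Integer.Properties as ℤP
open import Data.Integer.Tactic.RingSolver using (solve-∀)
open import Algebra.Properties.AbelianGroup ℤP.+-0-abelianGroup using ()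
  renaming (∙-cancelˡ to +-cancelˡ; ∙-cancelʳ to +-cancelʳ)
open import Data.Fin as F using (toℕ; inject₁; fromℕ<)
import Data.Fin.Properties as FP
open import Data.Fin.Induction using (<-weakInduction)
open import Data.Product as Prod using (_,_; proj₁; proj₂; ∃)
open import Data.Product.Properties using (≡-dec)
open import Data.Sum as Sum using (_⊎_; inj₁; inj₂; [_,_]; [_,_]′)
open import Data.List using (_∷_; map; allFin)
open import Data.List.Membership.Propositional using (_∈_)
open import Data.List.Membership.Propositional.Properties
  using (foldr-selective; ∈-map⁺; ∈-map⁻; ∈-allFin)
open import Data.List.Properties using (foldr-preservesᵒ)
import Data.List.Relation.Unary.Any as Any
open import Data.Empty using (⊥-elim)
open import Function using (_∘_; id; Injective; mk⇔)
open import Relation.Nullary using (Dec; yes; no)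
open import Relation.Binary.PropositionalEquality
  using (_≡_; refl; sym; trans; cong; cong₂; subst; subst₂; module ≡-Reasoning)

0ᵖ : Pt
0ᵖ = + 0 , + 0

infixl 6 _⊕_
_⊕_ : Pt → Pt → Pt
(x₁ , y₁) ⊕ (x₂ , y₂) = x₁ + x₂ , y₁ + y₂

-ᵖ_ : Pt → Pt
-ᵖ (x , y) = - x , - y

infix 7 _·_
_·_ : Pt → Pt → ℤ
(x₁ , y₁) · (x₂ , y₂) = x₁ * x₂ + y₁ * y₂

cross : Pt → Pt → ℤ
cross (x₁ , y₁) (x₂ , y₂) = x₁ * y₂ - y₁ * x₂

∥_∥² : Pt → ℤ
∥ a ∥² = a · a

⊕-comm : ∀ a b → a ⊕ b ≡ b ⊕ a
⊕-comm (x₁ , y₁) (x₂ , y₂) = cong₂ _,_ (ℤP.+-comm x₁ x₂) (ℤP.+-comm y₁ y₂)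

diff-self : ∀ a → diff a a ≡ 0ᵖ
diff-self (x , y) = cong₂ _,_ (ℤP.+-inverseʳ x) (ℤP.+-inverseʳ y)

diff≡0ᵖ⇒≡ : ∀ {a b} → diff a b ≡ 0ᵖ → a ≡ b
diff≡0ᵖ⇒≡ e = cong₂ _,_ (ℤP.i-j≡0⇒i≡j _ _ (cong proj₁ e)) (ℤP.i-j≡0⇒i≡j _ _ (cong proj₂ e))

diff-cancelʳ : ∀ {a b} c → diff a c ≡ diff b c → a ≡ b
diff-cancelʳ (x , y) e =
  cong₂ _,_ (+-cancelʳ (- x) _ _ (cong proj₁ e)) (+-cancelʳ (- y) _ _ (cong proj₂ e))

-ᵖ-diff : ∀ a b → -ᵖ diff a b ≡ diff b a
-ᵖ-diff (x₁ , y₁) (x₂ , y₂) = cong₂ _,_ (neg-minus x₁ x₂) (neg-minus y₁ y₂)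
  where
  neg-minus : ∀ x y → - (x - y) ≡ y - x
  neg-minus = solve-∀

diff-telescope : ∀ a b c → diff a b ⊕ diff b c ≡ diff a c
diff-telescope (x₁ , y₁) (x₂ , y₂) (x₃ , y₃) = cong₂ _,_ (telescope x₁ x₂ x₃) (telescope y₁ y₂ y₃)
  where
  telescope : ∀ x y z → (x - y) + (y - z) ≡ x - z
  telescope = solve-∀

diff-diff : ∀ a b c → diff (diff a c) (diff b c) ≡ diff a b
diff-diff (x₁ , y₁) (x₂ , y₂) (x₃ , y₃) = cong₂ _,_ (identity x₁ x₂ x₃) (identity y₁ y₂ y₃)
  where
  identity : ∀ x y z → (x - z) - (y - z) ≡ x - y
  identity = solve-∀

diff-⊕ˡ : ∀ a b c → diff (a ⊕ b) (a ⊕ c) ≡ diff b c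
diff-⊕ˡ (x₁ , y₁) (x₂ , y₂) (x₃ , y₃) = cong₂ _,_ (identity x₁ x₂ x₃) (identity y₁ y₂ y₃)
  where
  identity : ∀ x y z → (x + y) - (x + z) ≡ y - z
  identity = solve-∀

diff-⊕ʳ : ∀ a b c → diff (a ⊕ c) (b ⊕ c) ≡ diff a b
diff-⊕ʳ (x₁ , y₁) (x₂ , y₂) (x₃ , y₃) = cong₂ _,_ (identity x₁ x₂ x₃) (identity y₁ y₂ y₃)
  where
  identity : ∀ x y z → (x + z) - (y + z) ≡ x - y
  identity = solve-∀

diff≡diff⇒⊕≡⊕ : ∀ a b c d → diff a b ≡ diff c d → a ⊕ d ≡ b ⊕ c
diff≡diff⇒⊕≡⊕ (x₁ , y₁) (x₂ , y₂) (x₃ , y₃) (x₄ , y₄) e =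
  cong₂ _,_ (move x₁ x₂ x₃ x₄ (cong proj₁ e)) (move y₁ y₂ y₃ y₄ (cong proj₂ e))
  where
  move : ∀ x y z w → x - y ≡ z - w → x + w ≡ y + z
  move x y z w e = trans (identity x y w) (trans (cong (λ t → y + t + w) e) (identity′ y z w))
    where
    identity : ∀ x y w → x + w ≡ y + (x - y) + w
    identity = solve-∀
    identity′ : ∀ y z w → y + (z - w) + w ≡ y + z
    identity′ = solve-∀

⊕≡⊕⇒diff≡diff : ∀ a b c d → a ⊕ d ≡ b ⊕ c → diff a b ≡ diff c d
⊕≡⊕⇒diff≡diff (x₁ , y₁) (x₂ , y₂) (x₃ , y₃) (x₄ , y₄) e =
  cong₂ _,_ (move x₁ x₂ x₃ x₄ (cong proj₁ e)) (move y₁ y₂ y₃ y₄ (cong proj₂ e))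
  where
  move : ∀ x y z w → x + w ≡ y + z → x - y ≡ z - w
  move x y z w e = trans (identity x y w) (trans (cong (λ t → t - y - w) e) (identity′ y z w))
    where
    identity : ∀ x y w → x - y ≡ x + w - y - w
    identity = solve-∀
    identity′ : ∀ y z w → y + z - y - w ≡ z - w
    identity′ = solve-∀

⊕-diff-injective : ∀ {a b c d} → a ⊕ b ≡ c ⊕ d → diff a b ≡ diff c d → a ≡ c × b ≡ d
⊕-diff-injective {x₁ , y₁} {x₂ , y₂} {x₃ , y₃} {x₄ , y₄} s d =
  let x₁≡x₃ , x₂≡x₄ = halve (cong proj₁ s) (cong proj₁ d)
      y₁≡y₃ , y₂≡y₄ = halve (cong proj₂ s) (cong proj₂ d)
  in cong₂ _,_ x₁≡x₃ y₁≡y₃ , cong₂ _,_ x₂≡x₄ y₂≡y₄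
  where
  halve : ∀ {x y z w} → x + y ≡ z + w → x - y ≡ z - w → x ≡ z × y ≡ w
  halve {x} {y} {z} {w} s d = x≡z , +-cancelˡ z y w (trans (cong (_+ y) (sym x≡z)) s)
    where
    twice : ∀ x y → + 2 * x ≡ (x + y) + (x - y)
    twice = solve-∀
    x≡z : x ≡ z
    x≡z = ℤP.*-cancelˡ-≡ (+ 2) x z
      (trans (twice x y) (trans (cong₂ _+_ s d) (sym (twice z w))))

-- Euclidean geometry of ℤ²

i*i≡+∣i∣*∣i∣ : ∀ i → i * i ≡ + (∣ i ∣ ℕ.* ∣ i ∣)
i*i≡+∣i∣*∣i∣ (+ n)      = ℤP.+◃n≡+n (n ℕ.* n)
i*i≡+∣i∣*∣i∣ ℤ.-[1+ n ] = ℤP.+◃n≡+n (suc n ℕ.* suc n)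

i*i≡j*j⇒i≡j⊎i≡-j : ∀ i j → i * i ≡ j * j → i ≡ j ⊎ i ≡ - j
i*i≡j*j⇒i≡j⊎i≡-j i j e =
  Sum.map (ℤP.i-j≡0⇒i≡j i j)
          (λ i+j≡0 → trans (identity i j) (trans (cong (_- j) i+j≡0) (ℤP.+-identityˡ (- j))))
          (ℤP.i*j≡0⇒i≡0∨j≡0 (i - j) (trans (factor i j) (ℤP.i≡j⇒i-j≡0 e)))
  where
  factor : ∀ i j → (i - j) * (i + j) ≡ i * i - j * j
  factor = solve-∀
  identity : ∀ i j → i ≡ (i + j) - j
  identity = solve-∀

∥∥²≡0⇒≡0ᵖ : ∀ a → ∥ a ∥² ≡ + 0 → a ≡ 0ᵖ
∥∥²≡0⇒≡0ᵖ (x , y) e =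
  cong₂ _,_ (square≡0 x (ℕP.m+n≡0⇒m≡0 _ sum≡0)) (square≡0 y (ℕP.m+n≡0⇒n≡0 _ sum≡0))
  where
  sum≡0 : ∣ x ∣ ℕ.* ∣ x ∣ ℕ.+ ∣ y ∣ ℕ.* ∣ y ∣ ≡ 0
  sum≡0 = ℤP.+-injective (trans (sym (cong₂ _+_ (i*i≡+∣i∣*∣i∣ x) (i*i≡+∣i∣*∣i∣ y))) e)
  square≡0 : ∀ z → ∣ z ∣ ℕ.* ∣ z ∣ ≡ 0 → z ≡ + 0
  square≡0 z e = ℤP.∣i∣≡0⇒i≡0 ([ id , id ] (ℕP.m*n≡0⇒m≡0∨n≡0 ∣ z ∣ e))

⊥⇒cross≡0 : ∀ u v s → u · s ≡ + 0 → v · s ≡ + 0 → s ≢ 0ᵖ → cross u v ≡ + 0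
⊥⇒cross≡0 (u₁ , u₂) (v₁ , v₂) (s₁ , s₂) u⊥s v⊥s s≢0
  with ℤP.i*j≡0⇒i≡0∨j≡0 (u₁ * v₂ - u₂ * v₁)
         (trans (times-s₁ u₁ u₂ v₁ v₂ s₁ s₂) (vanishes v₂ u₂ u⊥s v⊥s))
     | ℤP.i*j≡0⇒i≡0∨j≡0 (u₁ * v₂ - u₂ * v₁)
         (trans (times-s₂ u₁ u₂ v₁ v₂ s₁ s₂) (vanishes u₁ v₁ v⊥s u⊥s))
  where
  times-s₁ : ∀ u₁ u₂ v₁ v₂ s₁ s₂ → (u₁ * v₂ - u₂ * v₁) * s₁
             ≡ v₂ * (u₁ * s₁ + u₂ * s₂) - u₂ * (v₁ * s₁ + v₂ * s₂)
  times-s₁ = solve-∀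
  times-s₂ : ∀ u₁ u₂ v₁ v₂ s₁ s₂ → (u₁ * v₂ - u₂ * v₁) * s₂
             ≡ u₁ * (v₁ * s₁ + v₂ * s₂) - v₁ * (u₁ * s₁ + u₂ * s₂)
  times-s₂ = solve-∀
  vanishes : ∀ a b {x y} → x ≡ + 0 → y ≡ + 0 → a * x - b * y ≡ + 0
  vanishes a b refl refl = identity a b
    where
    identity : ∀ a b → a * + 0 - b * + 0 ≡ + 0
    identity = solve-∀
... | inj₁ cross≡0 | _          = cross≡0
... | _          | inj₁ cross≡0 = cross≡0
... | inj₂ s₁≡0  | inj₂ s₂≡0   = ⊥-elim (s≢0 (cong₂ _,_ s₁≡0 s₂≡0))

lagrange : ∀ u v → (u · v) * (u · v) + cross u v * cross u v ≡ ∥ u ∥² * ∥ v ∥²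
lagrange (u₁ , u₂) (v₁ , v₂) = identity u₁ u₂ v₁ v₂
  where
  identity : ∀ u₁ u₂ v₁ v₂ →
    (u₁ * v₁ + u₂ * v₂) * (u₁ * v₁ + u₂ * v₂) + (u₁ * v₂ - u₂ * v₁) * (u₁ * v₂ - u₂ * v₁)
    ≡ (u₁ * u₁ + u₂ * u₂) * (v₁ * v₁ + v₂ * v₂)
  identity = solve-∀

∥diff∥² : ∀ u v → ∥ diff v u ∥² ≡ ∥ v ∥² + ∥ u ∥² - (u · v + u · v)
∥diff∥² (u₁ , u₂) (v₁ , v₂) = identity u₁ u₂ v₁ v₂
  where
  identity : ∀ u₁ u₂ v₁ v₂ → (v₁ - u₁) * (v₁ - u₁) + (v₂ - u₂) * (v₂ - u₂)
    ≡ (v₁ * v₁ + v₂ * v₂) + (u₁ * u₁ + u₂ * u₂) - ((u₁ * v₁ + u₂ * v₂) + (u₁ * v₁ + u₂ * v₂))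
  identity = solve-∀

∥diff-ᵖ∥² : ∀ u v → ∥ diff v (-ᵖ u) ∥² ≡ ∥ v ∥² + ∥ u ∥² + (u · v + u · v)
∥diff-ᵖ∥² (u₁ , u₂) (v₁ , v₂) = identity u₁ u₂ v₁ v₂
  where
  identity : ∀ u₁ u₂ v₁ v₂ → (v₁ - - u₁) * (v₁ - - u₁) + (v₂ - - u₂) * (v₂ - - u₂)
    ≡ (v₁ * v₁ + v₂ * v₂) + (u₁ * u₁ + u₂ * u₂) + ((u₁ * v₁ + u₂ * v₂) + (u₁ * v₁ + u₂ * v₂))
  identity = solve-∀

cross≡0⇒≡⊎≡-ᵖ : ∀ u v → cross u v ≡ + 0 → ∥ u ∥² ≡ ∥ v ∥² → v ≡ u ⊎ v ≡ -ᵖ u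
cross≡0⇒≡⊎≡-ᵖ u v cross≡0 ∥u∥≡∥v∥ =
  Sum.map (λ e → diff≡0ᵖ⇒≡ (∥∥²≡0⇒≡0ᵖ (diff v u) (v≡u e)))
          (λ e → diff≡0ᵖ⇒≡ (∥∥²≡0⇒≡0ᵖ (diff v (-ᵖ u)) (v≡-u e)))
          (i*i≡j*j⇒i≡j⊎i≡-j (u · v) ∥ u ∥² dot²)
  where
  open ≡-Reasoning
  N : ℤ
  N = ∥ u ∥²
  dot² : (u · v) * (u · v) ≡ N * N
  dot² = begin
    (u · v) * (u · v)                           ≡⟨ ℤP.+-identityʳ _ ⟨
    (u · v) * (u · v) + + 0                     ≡⟨ cong (λ c → (u · v) * (u · v) + c * c) cross≡0 ⟨
    (u · v) * (u · v) + cross u v * cross u v   ≡⟨ lagrange u v ⟩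
    N * ∥ v ∥²                                  ≡⟨ cong (N *_) ∥u∥≡∥v∥ ⟨
    N * N                                       ∎
  v≡u : u · v ≡ N → ∥ diff v u ∥² ≡ + 0
  v≡u e = begin
    ∥ diff v u ∥²                       ≡⟨ ∥diff∥² u v ⟩
    ∥ v ∥² + N - (u · v + u · v)        ≡⟨ cong₂ (λ a b → a + N - (b + b)) (sym ∥u∥≡∥v∥) e ⟩
    N + N - (N + N)                     ≡⟨ ℤP.+-inverseʳ (N + N) ⟩
    + 0                                 ∎
  v≡-u : u · v ≡ - N → ∥ diff v (-ᵖ u) ∥² ≡ + 0
  v≡-u e = begin
    ∥ diff v (-ᵖ u) ∥²                  ≡⟨ ∥diff-ᵖ∥² u v ⟩
    ∥ v ∥² + N + (u · v + u · v)        ≡⟨ cong₂ (λ a b → a + N + (b + b)) (sym ∥u∥≡∥v∥) e ⟩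
    N + N + (- N + - N)                 ≡⟨ cong (λ t → N + N + t) (ℤP.neg-distrib-+ N N) ⟨
    N + N - (N + N)                     ≡⟨ ℤP.+-inverseʳ (N + N) ⟩
    + 0                                 ∎

parallelogram-law : ∀ a b → ∥ diff a b ∥² + ∥ a ⊕ b ∥² ≡ (∥ a ∥² + ∥ b ∥²) + (∥ a ∥² + ∥ b ∥²)
parallelogram-law (a₁ , a₂) (b₁ , b₂) = identity a₁ a₂ b₁ b₂
  where
  identity : ∀ a₁ a₂ b₁ b₂ →
    ((a₁ - b₁) * (a₁ - b₁) + (a₂ - b₂) * (a₂ - b₂)) + ((a₁ + b₁) * (a₁ + b₁) + (a₂ + b₂) * (a₂ + b₂))
    ≡ ((a₁ * a₁ + a₂ * a₂) + (b₁ * b₁ + b₂ * b₂)) + ((a₁ * a₁ + a₂ * a₂) + (b₁ * b₁ + b₂ * b₂))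
  identity = solve-∀

∥∥²≡⇒diff⊥⊕ : ∀ a b → ∥ a ∥² ≡ ∥ b ∥² → diff a b · (a ⊕ b) ≡ + 0
∥∥²≡⇒diff⊥⊕ (a₁ , a₂) (b₁ , b₂) e = trans (identity a₁ a₂ b₁ b₂) (ℤP.i≡j⇒i-j≡0 e)
  where
  identity : ∀ a₁ a₂ b₁ b₂ → (a₁ - b₁) * (a₁ + b₁) + (a₂ - b₂) * (a₂ + b₂)
    ≡ (a₁ * a₁ + a₂ * a₂) - (b₁ * b₁ + b₂ * b₂)
  identity = solve-∀

-- The differences a − b and c − d are both orthogonal to the common diagonal
-- a + b = c + d and have the same length, so they are equal or opposite.
rhombus : ∀ a b c d {R} → a ⊕ b ≡ c ⊕ d → a ⊕ b ≢ 0ᵖ →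
          ∥ a ∥² ≡ R → ∥ b ∥² ≡ R → ∥ c ∥² ≡ R → ∥ d ∥² ≡ R →
          (c ≡ a × d ≡ b) ⊎ (c ≡ b × d ≡ a)
rhombus a b c d {R} s≡ s≢0 ∥a∥≡R ∥b∥≡R ∥c∥≡R ∥d∥≡R =
  Sum.map (⊕-diff-injective (sym s≡))
          (λ e → ⊕-diff-injective (trans (sym s≡) (⊕-comm a b)) (trans e (-ᵖ-diff a b)))
          (cross≡0⇒≡⊎≡-ᵖ (diff a b) (diff c d)
            (⊥⇒cross≡0 (diff a b) (diff c d) (a ⊕ b) ab⊥s cd⊥s s≢0) same-length)
  where
  open ≡-Reasoning
  ab⊥s : diff a b · (a ⊕ b) ≡ + 0
  ab⊥s = ∥∥²≡⇒diff⊥⊕ a b (trans ∥a∥≡R (sym ∥b∥≡R))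
  cd⊥s : diff c d · (a ⊕ b) ≡ + 0
  cd⊥s = trans (cong (diff c d ·_) s≡) (∥∥²≡⇒diff⊥⊕ c d (trans ∥c∥≡R (sym ∥d∥≡R)))
  same-length : ∥ diff a b ∥² ≡ ∥ diff c d ∥²
  same-length = +-cancelʳ ∥ a ⊕ b ∥² _ _ (begin
    ∥ diff a b ∥² + ∥ a ⊕ b ∥²                ≡⟨ parallelogram-law a b ⟩
    (∥ a ∥² + ∥ b ∥²) + (∥ a ∥² + ∥ b ∥²)     ≡⟨ cong₂ (λ x y → (x + y) + (x + y)) ∥a∥≡R ∥b∥≡R ⟩
    (R + R) + (R + R)                         ≡⟨ cong₂ (λ x y → (x + y) + (x + y)) ∥c∥≡R ∥d∥≡R ⟨
    (∥ c ∥² + ∥ d ∥²) + (∥ c ∥² + ∥ d ∥²)     ≡⟨ parallelogram-law c d ⟨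
    ∥ diff c d ∥² + ∥ c ⊕ d ∥²                ≡⟨ cong (λ s → ∥ diff c d ∥² + ∥ s ∥²) s≡ ⟨
    ∥ diff c d ∥² + ∥ a ⊕ b ∥²                ∎)

LeapAdj-sym : ∀ {p q} u v → LeapAdj p q u v → LeapAdj p q v u
LeapAdj-sym (x₁ , y₁) (x₂ , y₂) =
  Sum.map (Prod.map (flip x₁ x₂) (flip y₁ y₂)) (Prod.map (flip x₁ x₂) (flip y₁ y₂))
  where
  flip : ∀ x y {k} → ∣ x - y ∣ ≡ k → ∣ y - x ∣ ≡ k
  flip x y = trans (ℤP.∣i-j∣≡∣j-i∣ y x)

LeapAdj-diff : ∀ {p q} u v u′ v′ → diff u v ≡ diff u′ v′ → LeapAdj p q u v → LeapAdj p q u′ v′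
LeapAdj-diff {p} {q} _ _ _ _ = subst λ d →
  (∣ proj₁ d ∣ ≡ p × ∣ proj₂ d ∣ ≡ q) ⊎ (∣ proj₁ d ∣ ≡ q × ∣ proj₂ d ∣ ≡ p)

∣i∣≡n⇒i*i≡n*n : ∀ i {n} → ∣ i ∣ ≡ n → i * i ≡ + (n ℕ.* n)
∣i∣≡n⇒i*i≡n*n i refl = i*i≡+∣i∣*∣i∣ i

LeapAdj⇒∥diff∥² : ∀ {p q} u v → LeapAdj p q u v → ∥ diff u v ∥² ≡ + (p ℕ.* p) + + (q ℕ.* q)
LeapAdj⇒∥diff∥² (x₁ , y₁) (x₂ , y₂) (inj₁ (dx , dy)) =
  cong₂ _+_ (∣i∣≡n⇒i*i≡n*n (x₁ - x₂) dx) (∣i∣≡n⇒i*i≡n*n (y₁ - y₂) dy)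
LeapAdj⇒∥diff∥² {p} {q} (x₁ , y₁) (x₂ , y₂) (inj₂ (dx , dy)) =
  trans (cong₂ _+_ (∣i∣≡n⇒i*i≡n*n (x₁ - x₂) dx) (∣i∣≡n⇒i*i≡n*n (y₁ - y₂) dy))
        (ℤP.+-comm (+ (q ℕ.* q)) (+ (p ℕ.* p)))

-- All leaper moves have the same length, so the 4-cycle is a rhombus with
-- diagonal u w; the degenerate alternative x = v is excluded by v ≢ x.
LeapAdj-4-cycle⇒parallelogram : ∀ {p q} u v w x →
  LeapAdj p q u v → LeapAdj p q v w → LeapAdj p q u x → LeapAdj p q x w →
  u ≢ w → v ≢ x → diff u v ≡ diff x w
LeapAdj-4-cycle⇒parallelogram u v w x uv vw ux xw u≢w v≢x =
  [ (λ (_ , xw≡vw) → ⊥-elim (v≢x (sym (diff-cancelʳ w xw≡vw))))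
  , (λ (_ , xw≡uv) → sym xw≡uv) ]′
  (rhombus (diff u v) (diff v w) (diff u x) (diff x w)
           (trans (diff-telescope u v w) (sym (diff-telescope u x w)))
           (λ e → u≢w (diff≡0ᵖ⇒≡ (trans (sym (diff-telescope u v w)) e)))
           (LeapAdj⇒∥diff∥² u v uv) (LeapAdj⇒∥diff∥² v w vw)
           (LeapAdj⇒∥diff∥² u x ux) (LeapAdj⇒∥diff∥² x w xw))

-- Bounding boxes

∈⇒≤maxL : ∀ {y} xs → y ∈ xs → y ≤ maxL xs
∈⇒≤maxL {y} (x ∷ xs) y∈ = foldr-preservesᵒ {P = y ≤_} {f = _⊔_}
  (λ a b → [ ℤP.i≤j⇒i≤j⊔k b , ℤP.i≤j⇒i≤k⊔j a ]) x xs (Any.toSum (Any.map ℤP.≤-reflexive y∈))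

∈⇒minL≤ : ∀ {y} xs → y ∈ xs → minL xs ≤ y
∈⇒minL≤ {y} (x ∷ xs) y∈ = foldr-preservesᵒ {P = _≤ y} {f = _⊓_}
  (λ a b → [ ℤP.i≤j⇒i⊓k≤j b , ℤP.i≤j⇒k⊓i≤j a ]) x xs
  (Any.toSum (Any.map (ℤP.≤-reflexive ∘ sym) y∈))

maxL-∈ : ∀ {y} xs → y ∈ xs → maxL xs ∈ xs
maxL-∈ (x ∷ xs) _ = [ Any.here , Any.there ]′ (foldr-selective ℤP.⊔-sel x xs)

minL-∈ : ∀ {y} xs → y ∈ xs → minL xs ∈ xs
minL-∈ (x ∷ xs) _ = [ Any.here , Any.there ]′ (foldr-selective ℤP.⊓-sel x xs)

maxᶠ : ∀ {m} → (Fin m → ℤ) → ℤ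
maxᶠ {m} g = maxL (map g (allFin m))

minᶠ : ∀ {m} → (Fin m → ℤ) → ℤ
minᶠ {m} g = minL (map g (allFin m))

≤maxᶠ : ∀ {m} (g : Fin m → ℤ) i → g i ≤ maxᶠ g
≤maxᶠ g i = ∈⇒≤maxL _ (∈-map⁺ g (∈-allFin i))

minᶠ≤ : ∀ {m} (g : Fin m → ℤ) i → minᶠ g ≤ g i
minᶠ≤ g i = ∈⇒minL≤ _ (∈-map⁺ g (∈-allFin i))

maxᶠ-attained : ∀ {m} (g : Fin (suc m) → ℤ) → ∃ λ i → maxᶠ g ≡ g i
maxᶠ-attained g = let i , _ , e = ∈-map⁻ g (maxL-∈ _ (∈-map⁺ g (∈-allFin F.zero))) in i , e

minᶠ-attained : ∀ {m} (g : Fin (suc m) → ℤ) → ∃ λ i → minᶠ g ≡ g i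
minᶠ-attained g = let i , _ , e = ∈-map⁻ g (minL-∈ _ (∈-map⁺ g (∈-allFin F.zero))) in i , e

extent-+ : ∀ {m} (g h : Fin m → ℤ) →
           extent g + extent h ≡ + 2 + ((maxᶠ g + maxᶠ h) - (minᶠ g + minᶠ h))
extent-+ g h = identity (maxᶠ g) (minᶠ g) (maxᶠ h) (minᶠ h)
  where
  identity : ∀ a b c d → (a - b + + 1) + (c - d + + 1) ≡ + 2 + ((a + c) - (b + d))
  identity = solve-∀

FitsIn : ∀ {m} → ℕ → (Fin m → Fin m → ℤ) → Set
FitsIn n h = ∀ i j → Σ (Fin n) λ k → + toℕ k ≡ h i j

FitsIn⇒extent-+-≤ : ∀ {m n} (g h : Fin (suc m) → ℤ) →
                    FitsIn n (λ i j → g i + h j) → extent g + extent h ≤ + suc n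
FitsIn⇒extent-+-≤ {n = n} g h fits = begin
  extent g + extent h                                ≡⟨ extent-+ g h ⟩
  + 2 + ((maxᶠ g + maxᶠ h) - (minᶠ g + minᶠ h))       ≡⟨ cong₂ (λ a b → + 2 + (a - b)) max≡ min≡ ⟩
  + 2 + (+ toℕ top - + toℕ bottom)                   ≡⟨ cong (λ z → + 2 + z) (ℤP.m-n≡m⊖n (toℕ top) (toℕ bottom)) ⟩
  + 2 + (toℕ top ⊖ toℕ bottom)                       ≤⟨ ℤP.+-monoʳ-≤ (+ 2) (ℤP.m⊖n≤m (toℕ top) (toℕ bottom)) ⟩
  + (2 ℕ.+ toℕ top)                                  ≤⟨ ℤ.+≤+ (ℕ.s≤s (FP.toℕ<n top)) ⟩
  + suc n                                            ∎
  where
  open ℤP.≤-Reasoning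
  i₊ = proj₁ (maxᶠ-attained g)
  j₊ = proj₁ (maxᶠ-attained h)
  i₋ = proj₁ (minᶠ-attained g)
  j₋ = proj₁ (minᶠ-attained h)
  top = proj₁ (fits i₊ j₊)
  bottom = proj₁ (fits i₋ j₋)
  max≡ : maxᶠ g + maxᶠ h ≡ + toℕ top
  max≡ = trans (cong₂ _+_ (proj₂ (maxᶠ-attained g)) (proj₂ (maxᶠ-attained h)))
               (sym (proj₂ (fits i₊ j₊)))
  min≡ : minᶠ g + minᶠ h ≡ + toℕ bottom
  min≡ = trans (cong₂ _+_ (proj₂ (minᶠ-attained g)) (proj₂ (minᶠ-attained h)))
               (sym (proj₂ (fits i₋ j₋)))

toFin : ∀ {n z} → + 0 ≤ z → + 1 + z ≤ + n → Σ (Fin n) λ k → + toℕ k ≡ z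
toFin (ℤ.+≤+ _) (ℤ.+≤+ k<n) = fromℕ< k<n , cong +_ (FP.toℕ-fromℕ< k<n)

extent-+-≤⇒FitsIn : ∀ {m n} (g h : Fin m → ℤ) → extent g + extent h ≤ + suc n →
                    FitsIn n (λ i j → g i + h j - (minᶠ g + minᶠ h))
extent-+-≤⇒FitsIn {n = n} g h bound i j = toFin lower upper
  where
  open ℤP.≤-Reasoning
  lower : + 0 ≤ g i + h j - (minᶠ g + minᶠ h)
  lower = ℤP.i≤j⇒0≤j-i (ℤP.+-mono-≤ (minᶠ≤ g i) (minᶠ≤ h j))
  shift : ∀ w → + 1 + w ≡ ℤ.pred (+ 2 + w)
  shift w = identity w
    where
    identity : ∀ w → + 1 + w ≡ - + 1 + (+ 2 + w)
    identity = solve-∀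
  upper : + 1 + (g i + h j - (minᶠ g + minᶠ h)) ≤ + n
  upper = begin
    + 1 + (g i + h j - (minᶠ g + minᶠ h))               ≤⟨ ℤP.+-monoʳ-≤ (+ 1) (ℤP.+-monoˡ-≤ (- (minᶠ g + minᶠ h))
                                                             (ℤP.+-mono-≤ (≤maxᶠ g i) (≤maxᶠ h j))) ⟩
    + 1 + ((maxᶠ g + maxᶠ h) - (minᶠ g + minᶠ h))       ≡⟨ shift ((maxᶠ g + maxᶠ h) - (minᶠ g + minᶠ h)) ⟩
    ℤ.pred (+ 2 + ((maxᶠ g + maxᶠ h) - (minᶠ g + minᶠ h))) ≡⟨ cong ℤ.pred (extent-+ g h) ⟨
    ℤ.pred (extent g + extent h)                         ≤⟨ ℤP.pred-mono bound ⟩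
    + n                                                  ∎

∣m⊖n∣≡1⇒adjacent : ∀ m n → ∣ m ⊖ n ∣ ≡ 1 → suc m ≡ n ⊎ suc n ≡ m
∣m⊖n∣≡1⇒adjacent 0             1             _ = inj₁ refl
∣m⊖n∣≡1⇒adjacent 1             0             _ = inj₂ refl
∣m⊖n∣≡1⇒adjacent (suc m)       (suc n)       d =
  Sum.map (cong suc) (cong suc)
    (∣m⊖n∣≡1⇒adjacent m n (trans (cong ∣_∣ (sym (ℤP.[1+m]⊖[1+n]≡m⊖n m n))) d))
∣m⊖n∣≡1⇒adjacent 0             0             ()
∣m⊖n∣≡1⇒adjacent 0             (suc (suc n)) ()
∣m⊖n∣≡1⇒adjacent (suc (suc m)) 0             ()

∣m⊖1+m∣≡1 : ∀ m → ∣ m ⊖ suc m ∣ ≡ 1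
∣m⊖1+m∣≡1 0       = refl
∣m⊖1+m∣≡1 (suc m) = trans (cong ∣_∣ (ℤP.[1+m]⊖[1+n]≡m⊖n m (suc m))) (∣m⊖1+m∣≡1 m)

∣+m-+n∣≡1⇒adjacent : ∀ m n → ∣ + m - + n ∣ ≡ 1 → suc m ≡ n ⊎ suc n ≡ m
∣+m-+n∣≡1⇒adjacent m n d = ∣m⊖n∣≡1⇒adjacent m n (trans (cong ∣_∣ (sym (ℤP.m-n≡m⊖n m n))) d)

1+m≡n⇒∣+m-+n∣≡1 : ∀ {m n} → suc m ≡ n → ∣ + m - + n ∣ ≡ 1
1+m≡n⇒∣+m-+n∣≡1 {m} refl = trans (cong ∣_∣ (ℤP.m-n≡m⊖n m (suc m))) (∣m⊖1+m∣≡1 m)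

IsLeaperPath-unitStep : ∀ {p q m γ} → IsLeaperPath p q m γ →
                        ∀ i k → ∣ + toℕ i - + toℕ k ∣ ≡ 1 → LeapAdj p q (γ i) (γ k)
IsLeaperPath-unitStep {γ = γ} (_ , edge) i k d =
  [ edge i k , LeapAdj-sym (γ k) (γ i) ∘ edge k i ] (∣+m-+n∣≡1⇒adjacent (toℕ i) (toℕ k) d)

IsLeaperPath-translate : ∀ {p q m γ} o → IsLeaperPath p q m γ →
                         IsLeaperPath p q m (λ i → diff (γ i) o)
IsLeaperPath-translate {γ = γ} o (injective , edge) =
  (λ e → injective (diff-cancelʳ o e)) ,
  (λ i k s → LeapAdj-diff (γ i) (γ k) (diff (γ i) o) (diff (γ k) o)
               (sym (diff-diff (γ i) (γ k) o)) (edge i k s))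

toPt-injective : ∀ {n} (u v : Fin n × Fin n) → toPt u ≡ toPt v → u ≡ v
toPt-injective _ _ e = cong₂ _,_ (FP.toℕ-injective (ℤP.+-injective (cong proj₁ e)))
                                 (FP.toℕ-injective (ℤP.+-injective (cong proj₂ e)))

1+toℕ-inject₁ : ∀ {m} (i : Fin m) → suc (toℕ (inject₁ i)) ≡ toℕ (F.suc i)
1+toℕ-inject₁ i = cong suc (FP.toℕ-inject₁ i)

inject₁≢suc : ∀ {m} (i : Fin m) → inject₁ i ≢ F.suc i
inject₁≢suc i e = ℕP.1+n≢n (sym (trans (cong toℕ e) (sym (1+toℕ-inject₁ i))))

⊕-injective⇒DisjointDifferences : ∀ {m} (α β : Fin m → Pt) →
  (∀ i j k l → α i ⊕ β j ≡ α k ⊕ β l → i ≡ k) → DisjointDifferences α β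
⊕-injective⇒DisjointDifferences α β injective i j k l αi≢αj _ e =
  αi≢αj (cong α (injective i l j k (diff≡diff⇒⊕≡⊕ (α i) (α j) (β k) (β l) e)))

DisjointDifferences⇒⊕-injective : ∀ {m} (α β : Fin m → Pt) →
  Injective _≡_ _≡_ α → Injective _≡_ _≡_ β → DisjointDifferences α β →
  ∀ i j k l → α i ⊕ β j ≡ α k ⊕ β l → i ≡ k × j ≡ l
DisjointDifferences⇒⊕-injective α β α-injective β-injective disjoint i j k l e =
  decide (≡-dec ℤP._≟_ ℤP._≟_ (α i) (α k))
  where
  δ : diff (α i) (α k) ≡ diff (β l) (β j)
  δ = ⊕≡⊕⇒diff≡diff (α i) (α k) (β l) (β j) e
  decide : Dec (α i ≡ α k) → i ≡ k × j ≡ l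
  decide (yes αi≡αk) = α-injective αi≡αk , sym (β-injective (diff≡0ᵖ⇒≡
    (trans (sym δ) (trans (cong (λ z → diff z (α k)) αi≡αk) (diff-self (α k))))))
  decide (no αi≢αk) = ⊥-elim (disjoint i k l j αi≢αk βl≢βj δ)
    where
    βl≢βj : β l ≢ β j
    βl≢βj βl≡βj = αi≢αk (diff≡0ᵖ⇒≡
      (trans δ (trans (cong (λ z → diff z (β j)) βl≡βj) (diff-self (β j)))))

squares-parallel⇒separable : ∀ {m} (g : Fin (suc m) → Fin (suc m) → ℤ) →
  (∀ i j → g (inject₁ i) (inject₁ j) - g (F.suc i) (inject₁ j)
         ≡ g (inject₁ i) (F.suc j) - g (F.suc i) (F.suc j)) →
  ∀ i j → g i j ≡ g i F.zero + (g F.zero j - g F.zero F.zero)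
squares-parallel⇒separable {m} g square = <-weakInduction Separated first next
  where
  open ≡-Reasoning
  Separated : Fin (suc m) → Set
  Separated i = ∀ j → g i j ≡ g i F.zero + (g F.zero j - g F.zero F.zero)
  first : Separated F.zero
  first j = identity (g F.zero j) (g F.zero F.zero)
    where
    identity : ∀ a b → a ≡ b + (a - b)
    identity = solve-∀
  gap : Fin m → Fin (suc m) → ℤ
  gap i j = g (inject₁ i) j - g (F.suc i) j
  gap-constant : ∀ i j → gap i j ≡ gap i F.zero
  gap-constant i = <-weakInduction (λ j → gap i j ≡ gap i F.zero) refl
                                   (λ j ih → trans (sym (square i j)) ih)
  next : ∀ i → Separated (inject₁ i) → Separated (F.suc i)
  next i ih j = begin
    g (F.suc i) j                               ≡⟨ identity (g (inject₁ i) j) (g (F.suc i) j) ⟩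
    g (inject₁ i) j - gap i j                   ≡⟨ cong₂ _-_ (ih j) (gap-constant i j) ⟩
    (g (inject₁ i) F.zero + t) - gap i F.zero   ≡⟨ identity′ (g (inject₁ i) F.zero) (g (F.suc i) F.zero) t ⟩
    g (F.suc i) F.zero + t                      ∎
    where
    t = g F.zero j - g F.zero F.zero
    identity : ∀ a b → b ≡ a - (a - b)
    identity = solve-∀
    identity′ : ∀ a b t → (a + t) - (a - b) ≡ b + t
    identity′ = solve-∀

-- From an embedding of the grid to two paths

module EmbeddingToPaths {p q m n : ℕ} (f : Fin (suc m) × Fin (suc m) → Fin n × Fin n)
  (f-injective : Injective _≡_ _≡_ f)
  (f-edges : ∀ u v → GridAdj u v → LeapAdjₙ p q (f u) (f v)) where

  P : Fin (suc m) → Fin (suc m) → Pt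
  P i j = toPt (f (i , j))

  P-injective : ∀ {i j k l} → P i j ≡ P k l → (i , j) ≡ (k , l)
  P-injective e = f-injective (toPt-injective _ _ e)

  P-edge₁ : ∀ {i k} j → suc (toℕ i) ≡ toℕ k → LeapAdj p q (P i j) (P k j)
  P-edge₁ j s = f-edges _ _ (inj₂ (refl , 1+m≡n⇒∣+m-+n∣≡1 s))

  P-edge₂ : ∀ i {j l} → suc (toℕ j) ≡ toℕ l → LeapAdj p q (P i j) (P i l)
  P-edge₂ i s = f-edges _ _ (inj₁ (refl , 1+m≡n⇒∣+m-+n∣≡1 s))

  P-square : ∀ i j → diff (P (inject₁ i) (inject₁ j)) (P (F.suc i) (inject₁ j))
                   ≡ diff (P (inject₁ i) (F.suc j)) (P (F.suc i) (F.suc j))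
  P-square i j = LeapAdj-4-cycle⇒parallelogram _ _ _ _
    (P-edge₁ _ (1+toℕ-inject₁ i)) (P-edge₂ _ (1+toℕ-inject₁ j))
    (P-edge₂ _ (1+toℕ-inject₁ j)) (P-edge₁ _ (1+toℕ-inject₁ i))
    (λ e → inject₁≢suc i (cong proj₁ (P-injective e)))
    (λ e → inject₁≢suc i (sym (cong proj₁ (P-injective e))))

  α β : Fin (suc m) → Pt
  α i = P i F.zero
  β j = diff (P F.zero j) (P F.zero F.zero)

  P≡α⊕β : ∀ i j → P i j ≡ α i ⊕ β j
  P≡α⊕β i j = cong₂ _,_
    (squares-parallel⇒separable (λ i j → proj₁ (P i j)) (λ i j → cong proj₁ (P-square i j)) i j)
    (squares-parallel⇒separable (λ i j → proj₂ (P i j)) (λ i j → cong proj₂ (P-square i j)) i j)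

  α-path : IsLeaperPath p q (suc m) α
  α-path = (λ e → cong proj₁ (P-injective e)) , (λ _ _ s → P-edge₁ F.zero s)

  β-path : IsLeaperPath p q (suc m) β
  β-path = IsLeaperPath-translate (P F.zero F.zero)
    ((λ e → cong proj₂ (P-injective e)) , (λ _ _ s → P-edge₂ F.zero s))

  disjoint : DisjointDifferences α β
  disjoint = ⊕-injective⇒DisjointDifferences α β λ i j k l e →
    cong proj₁ (P-injective (trans (P≡α⊕β i j) (trans e (sym (P≡α⊕β k l)))))

  widthX-bound : widthX α + widthX β ≤ + suc n
  widthX-bound = FitsIn⇒extent-+-≤ (proj₁ ∘ α) (proj₁ ∘ β)
    (λ i j → proj₁ (f (i , j)) , cong proj₁ (P≡α⊕β i j))

  widthY-bound : widthY α + widthY β ≤ + suc n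
  widthY-bound = FitsIn⇒extent-+-≤ (proj₂ ∘ α) (proj₂ ∘ β)
    (λ i j → proj₂ (f (i , j)) , cong proj₂ (P≡α⊕β i j))

-- From two paths to an embedding of the grid

module PathsToEmbedding {p q m n : ℕ} {α β : Fin m → Pt}
  (α-path : IsLeaperPath p q m α) (β-path : IsLeaperPath p q m β)
  (disjoint : DisjointDifferences α β)
  (widthX-bound : widthX α + widthX β ≤ + suc n)
  (widthY-bound : widthY α + widthY β ≤ + suc n) where

  corner : Pt
  corner = minᶠ (proj₁ ∘ α) + minᶠ (proj₁ ∘ β) , minᶠ (proj₂ ∘ α) + minᶠ (proj₂ ∘ β)

  Q : Fin m → Fin m → Pt
  Q i j = diff (α i ⊕ β j) corner

  fitsX : FitsIn n (λ i j → proj₁ (Q i j))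
  fitsX = extent-+-≤⇒FitsIn (proj₁ ∘ α) (proj₁ ∘ β) widthX-bound

  fitsY : FitsIn n (λ i j → proj₂ (Q i j))
  fitsY = extent-+-≤⇒FitsIn (proj₂ ∘ α) (proj₂ ∘ β) widthY-bound

  f : Fin m × Fin m → Fin n × Fin n
  f (i , j) = proj₁ (fitsX i j) , proj₁ (fitsY i j)

  toPt-f : ∀ i j → toPt (f (i , j)) ≡ Q i j
  toPt-f i j = cong₂ _,_ (proj₂ (fitsX i j)) (proj₂ (fitsY i j))

  f-injective : Injective _≡_ _≡_ f
  f-injective {i , j} {k , l} e =
    let Qij≡Qkl = trans (sym (toPt-f i j)) (trans (cong toPt e) (toPt-f k l))
        i≡k , j≡l = DisjointDifferences⇒⊕-injective α β (proj₁ α-path) (proj₁ β-path) disjoint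
                      i j k l (diff-cancelʳ corner Qij≡Qkl)
    in cong₂ _,_ i≡k j≡l

  f-edges : ∀ u v → GridAdj u v → LeapAdjₙ p q (f u) (f v)
  f-edges (i , j) (.i , l) (inj₁ (refl , d)) =
    subst₂ (LeapAdj p q) (sym (toPt-f i j)) (sym (toPt-f i l))
      (LeapAdj-diff (β j) (β l) (Q i j) (Q i l)
        (sym (trans (diff-diff (α i ⊕ β j) (α i ⊕ β l) corner) (diff-⊕ˡ (α i) (β j) (β l))))
        (IsLeaperPath-unitStep β-path j l d))
  f-edges (i , j) (k , .j) (inj₂ (refl , d)) =
    subst₂ (LeapAdj p q) (sym (toPt-f i j)) (sym (toPt-f k j))
      (LeapAdj-diff (α i) (α k) (Q i j) (Q k j)
        (sym (trans (diff-diff (α i ⊕ β j) (α k ⊕ β j) corner) (diff-⊕ʳ (α i) (α k) (β j))))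
        (IsLeaperPath-unitStep α-path i k d))

lemma3 : (p q m n : ℕ) → 0 < p → 0 < q → p ≢ q → 0 < m → 0 < n →
    GridEmbedsInLeaper p q m n ⇔
      (Σ (Fin m → Pt) λ α → Σ (Fin m → Pt) λ β →
        IsLeaperPath p q m α × IsLeaperPath p q m β ×
        DisjointDifferences α β ×
        (widthX α + widthX β ≤ + suc n) × (widthY α + widthY β ≤ + suc n))
lemma3 p q (suc m) n _ _ _ _ _ = mk⇔
  (λ (f , f-injective , f-edges) →
    let open EmbeddingToPaths f f-injective f-edges
    in α , β , α-path , β-path , disjoint , widthX-bound , widthY-bound)
  (λ (α , β , α-path , β-path , disjoint , widthX-bound , widthY-bound) →
    let open PathsToEmbedding α-path β-path disjoint widthX-bound widthY-bound
    in f , f-injective , f-edges)
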